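{- For each integer $\sigma\ge 2$, $\mathit{SQ}'_{\mathrm{Abel}}(n,\sigma)=\Omega(n^{3/2})$.
   Context: For a word $w$ over the alphabet $\{0,\ldots,\sigma-1\}$, its Parikh vector is $P(w)=(|w|_0,\ldots,|w|_{\sigma-1})$, where $|w|_c$ counts occurrences of $c$. An Abelian square is a word $uv$ with $u,v$ nonempty, $|u|=|v|$ and $P(u)=P(v)$. Two Abelian squares are equivalent (in the Abelian sense) if they have the same Parikh vector. $\mathit{SQ}'_{\mathrm{Abel}}(n,\sigma)$ is the maximum, over all words $w$ of length $n$ over an alphabet of size $\sigma$, of the number of pairwise nonequivalent Abelian squares occurring as subwords (contiguous factors) of $w$. -}

module Defs where

open import Data.Nat using (ℕ; zero; suc; _+_; _*_; _≤_; _⊔_; _≟_; _≤?_)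
open import Data.Fin using (Fin)
import Data.Fin as F
open import Data.List using (List; []; _∷_; length; map; concatMap; filter; deduplicate; take; drop; tails; applyUpTo; allFin; foldr; _++_)
open import Data.Vec using (Vec; tabulate)
open import Data.Vec.Properties using (≡-dec)
open import Data.Product using (_×_; _,_; proj₁; proj₂)
open import Relation.Binary.PropositionalEquality using (_≡_)
open import Relation.Nullary.Decidable using (Dec; yes; no; _×-dec_)

occ : ∀ {σ} → Fin σ → List (Fin σ) → ℕ
occ c [] = 0
occ c (x ∷ w) with c F.≟ x
... | yes _ = suc (occ c w)
... | no  _ = occ c w

parikh : ∀ {σ} → List (Fin σ) → Vec ℕ σ
parikh w = tabulate (λ c → occ c w)

IsAbelSq : ∀ {σ} → List (Fin σ) × List (Fin σ) → Set
IsAbelSq (u , v) = (1 ≤ length u) × (length u ≡ length v) × (parikh u ≡ parikh v)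

isAbelSq? : ∀ {σ} (p : List (Fin σ) × List (Fin σ)) → Dec (IsAbelSq p)
isAbelSq? (u , v) = (1 ≤? length u) ×-dec ((length u ≟ length v) ×-dec ≡-dec _≟_ (parikh u) (parikh v))

-- All pairs (u , v) such that u v is a factor (contiguous subword) of w
-- with |u| = k ≥ 1 (v is the next k letters, possibly truncated at the end).
splitPairs : ∀ {σ} → List (Fin σ) → List (List (Fin σ) × List (Fin σ))
splitPairs w = concatMap (λ s → applyUpTo (λ i → take (suc i) s , take (suc i) (drop (suc i) s)) (length s)) (tails w)

abelSqPVs : ∀ {σ} → List (Fin σ) → List (Vec ℕ σ)
abelSqPVs w = map (λ p → parikh (proj₁ p ++ proj₂ p)) (filter isAbelSq? (splitPairs w))

-- Number of pairwise nonequivalent (distinct Parikh vector) Abelian squares in w.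
numAbelSq : ∀ {σ} → List (Fin σ) → ℕ
numAbelSq w = length (deduplicate (≡-dec _≟_) (abelSqPVs w))

allWords : (σ n : ℕ) → List (List (Fin σ))
allWords σ zero = [] ∷ []
allWords σ (suc n) = concatMap (λ w → map (_∷ w) (allFin σ)) (allWords σ n)

SQ'Abel : ℕ → ℕ → ℕ
SQ'Abel n σ = foldr _⊔_ 0 (map numAbelSq (allWords σ n))

-- Over letters a, b and for t ≥ 1 take the word
--   (a^{2t} b^{2t})^{2t} (ab)^{4t²} (b^{2t+2} a^{2t+2})^t   of length 20t² + 4t.
-- For i < t and j, z < 2t it contains the factor u v with
--   u = b^z (a^{2t} b^{2t})^j (ab)^p,   v = (ab)^q (b^{2t+2} a^{2t+2})^i b^z,
-- where p + q = 4t² is split so that u and v both contain h = 2t² + i + (i + j) t letters a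
-- and z + h letters b.  Then u v is an Abelian square with Parikh vector (2h, 2(z + h), 0, …),
-- and i, j, z are recovered from h and z since i < t.  So a word of length n ≈ 24 t² (padded
-- with a's) has at least 4t³ nonequivalent Abelian squares, i.e. n³ = O(SQ'_Abel(n,σ)²).

module Submission where

open import Defs
open import Data.Nat using (ℕ; _≤_; _*_; _^_)
open import Data.Product using (∃-syntax)

open import Data.Nat using (zero; suc; _+_; _∸_; _<_; _⊔_; _≟_; _≤?_; z≤n; s≤s; NonZero; >-nonZero⁻¹)
open import Data.Nat.DivMod using (_%_; [m+kn]%n≡m%n; m<n⇒m%n≡m)
open import Data.Nat.ListAction using (sum)
open import Data.Nat.ListAction.Properties using (sum-++)
open import Data.Nat.Properties
open import Data.Nat.Solver using (module +-*-Solver)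
open import Data.Fin using (Fin; toℕ) renaming (_≟_ to _≟ᶠ_)
open import Data.Fin.Patterns using (0F; 1F)
open import Data.Fin.Properties using (toℕ<n; toℕ-injective)
import Algebra.Solver.Monoid as MonoidSolver
open import Data.List
  using (List; []; _∷_; [_]; _++_; length; map; take; drop; tails; applyUpTo; allFin; cartesianProduct; foldr)
open import Data.List.Properties using (++-assoc; length-++; length-map; map-++; length-tabulate; ++-monoid)
open import Data.List.Membership.Propositional using (_∈_)
open import Data.List.Membership.Propositional.Properties
  using (∈-map⁺; ∈-map⁻; ∈-concat⁺′; ∈-applyUpTo⁺; ∈-filter⁺; ∈-deduplicate⁺; ∈-allFin)
open import Data.List.Relation.Binary.Subset.Propositional using (_⊆_)
open import Data.List.Relation.Unary.Any using (here; there)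
import Data.List.Relation.Unary.All as All
open import Data.List.Relation.Unary.AllPairs using (_∷_)
open import Data.List.Relation.Unary.Unique.Propositional using (Unique)
import Data.List.Relation.Unary.Unique.Propositional.Properties as Unique
open import Data.Vec using (Vec; lookup)
open import Data.Vec.Properties using (tabulate-cong; lookup∘tabulate; ≡-dec)
open import Data.Product using (_×_; _,_; proj₁; proj₂)
open import Data.Sum using (inj₁; inj₂)
open import Relation.Binary.PropositionalEquality
  using (_≡_; _≢_; refl; sym; trans; cong; cong₂; subst; module ≡-Reasoning)
open import Relation.Nullary using (yes; no; contradiction)
open +-*-Solver using (solve; _:+_; _:*_; _:^_; _:=_; con)

private variable
  A : Set
  σ : ℕ

copies : ℕ → List A → List A
copies zero    w = []
copies (suc n) w = w ++ copies n w

copies-+ : ∀ m n (w : List A) → copies (m + n) w ≡ copies m w ++ copies n w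
copies-+ zero    n w = refl
copies-+ (suc m) n w =
  trans (cong (w ++_) (copies-+ m n w)) (sym (++-assoc w (copies m w) (copies n w)))

length-copies-singleton : ∀ n {x : A} → length (copies n [ x ]) ≡ n
length-copies-singleton zero    = refl
length-copies-singleton (suc n) = cong suc (length-copies-singleton n)

copies-split : ∀ m n {k} (w : List A) → m + n ≡ k → copies k w ≡ copies m w ++ copies n w
copies-split m n w refl = copies-+ m n w

copies-around : ∀ {m n k} {w x y : List A} → m + suc n ≡ k → w ≡ x ++ y →
  copies k w ≡ (copies m w ++ x) ++ (y ++ copies n w)
copies-around {m = m} {n} {x = x} {y} refl refl = begin
  copies (m + suc n) (x ++ y)  ≡⟨ copies-+ m (suc n) (x ++ y) ⟩
  C ++ (x ++ y) ++ D           ≡⟨ cong (C ++_) (++-assoc x y D) ⟩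
  C ++ x ++ y ++ D             ≡⟨ ++-assoc C x (y ++ D) ⟨
  (C ++ x) ++ y ++ D           ∎
  where
  open ≡-Reasoning
  C D : List _
  C = copies m (x ++ y)
  D = copies n (x ++ y)

weight : (A → ℕ) → List A → ℕ
weight f w = sum (map f w)

weight-++ : ∀ (f : A → ℕ) x y → weight f (x ++ y) ≡ weight f x + weight f y
weight-++ f x y = trans (cong sum (map-++ f x y)) (sum-++ (map f x) (map f y))

weight-copies : ∀ (f : A → ℕ) n w → weight f (copies n w) ≡ n * weight f w
weight-copies f zero    w = refl
weight-copies f (suc n) w =
  trans (weight-++ f w (copies n w)) (cong (weight f w +_) (weight-copies f n w))

length≡weight : (w : List A) → length w ≡ weight (λ _ → 1) w
length≡weight []      = refl
length≡weight (x ∷ w) = cong suc (length≡weight w)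

indicator : Fin σ → Fin σ → ℕ
indicator c x with c ≟ᶠ x
... | yes _ = 1
... | no  _ = 0

occ≡weight : ∀ (c : Fin σ) w → occ c w ≡ weight (indicator c) w
occ≡weight c []      = refl
occ≡weight c (x ∷ w) with c ≟ᶠ x
... | yes _ = cong suc (occ≡weight c w)
... | no  _ = occ≡weight c w

occ-cong : ∀ {u v : List (Fin σ)} → parikh u ≡ parikh v → ∀ c → occ c u ≡ occ c v
occ-cong {u = u} {v} eq c =
  trans (sym (lookup∘tabulate (λ c → occ c u) c))
    (trans (cong (λ p → lookup p c) eq) (lookup∘tabulate (λ c → occ c v) c))

equal-weights⇒IsAbelSq : ∀ {u v : List (Fin σ)} → 1 ≤ length u →
  (∀ f → weight f u ≡ weight f v) → IsAbelSq (u , v)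
equal-weights⇒IsAbelSq {u = u} {v} 1≤|u| eq =
  1≤|u| ,
  trans (length≡weight u) (trans (eq _) (sym (length≡weight v))) ,
  tabulate-cong (λ c → trans (occ≡weight c u) (trans (eq (indicator c)) (sym (occ≡weight c v))))

∈-tails : ∀ (pre s : List A) → s ∈ tails (pre ++ s)
∈-tails []        []      = here refl
∈-tails []        (x ∷ s) = here refl
∈-tails (x ∷ pre) s       = there (∈-tails pre s)

take-length-++ : ∀ (u r : List A) → take (length u) (u ++ r) ≡ u
take-length-++ []      r = refl
take-length-++ (x ∷ u) r = cong (x ∷_) (take-length-++ u r)

drop-length-++ : ∀ (u r : List A) → drop (length u) (u ++ r) ≡ r
drop-length-++ []      r = refl
drop-length-++ (x ∷ u) r = drop-length-++ u r

∈-splitPairs : ∀ (pre u v post : List (Fin σ)) → 1 ≤ length u → length u ≡ length v →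
  (u , v) ∈ splitPairs (pre ++ u ++ v ++ post)
∈-splitPairs pre u v post 1≤|u| |u|≡|v| =
  ∈-concat⁺′ (subst (_∈ pairsIn s) split (∈-applyUpTo⁺ (pairAt s) k<|s|)) (∈-map⁺ pairsIn (∈-tails pre s))
  where
  pairAt : List (Fin _) → ℕ → List (Fin _) × List (Fin _)
  pairAt s i = take (suc i) s , take (suc i) (drop (suc i) s)
  pairsIn : List (Fin _) → List (List (Fin _) × List (Fin _))
  pairsIn s = applyUpTo (pairAt s) (length s)
  s = u ++ v ++ post
  k = length u ∸ 1
  1+k≡|u| : suc k ≡ length u
  1+k≡|u| = m+[n∸m]≡n 1≤|u|
  k<|s| : k < length s
  k<|s| = ≤-trans (≤-reflexive 1+k≡|u|) (≤-trans (m≤m+n (length u) _) (≤-reflexive (sym (length-++ u))))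
  split : pairAt s k ≡ (u , v)
  split rewrite 1+k≡|u| | take-length-++ u (v ++ post) | drop-length-++ u (v ++ post) | |u|≡|v| =
    cong (u ,_) (take-length-++ v post)

∈-abelSqPVs : ∀ (pre u v post : List (Fin σ)) → IsAbelSq (u , v) →
  parikh (u ++ v) ∈ abelSqPVs (pre ++ u ++ v ++ post)
∈-abelSqPVs pre u v post sq@(1≤|u| , |u|≡|v| , _) =
  ∈-map⁺ (λ p → parikh (proj₁ p ++ proj₂ p))
    (∈-filter⁺ isAbelSq? (∈-splitPairs pre u v post 1≤|u| |u|≡|v|) sq)

∈-remove : ∀ {x : A} {ys} → x ∈ ys →
  ∃[ ys′ ] length ys ≡ suc (length ys′) × (∀ {y} → y ∈ ys → y ≢ x → y ∈ ys′)
∈-remove {ys = y ∷ ys} (here refl) = ys , refl , λ { (here y≡x) y≢x → contradiction y≡x y≢x ; (there p) _ → p }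
∈-remove {ys = y ∷ ys} (there x∈ys) with ys′ , eq , keep ← ∈-remove x∈ys =
  y ∷ ys′ , cong suc eq , λ { (here refl) _ → here refl ; (there p) y≢x → there (keep p y≢x) }

Unique-⊆⇒length≤ : ∀ {xs ys : List A} → Unique xs → xs ⊆ ys → length xs ≤ length ys
Unique-⊆⇒length≤ {xs = []}     _            _   = z≤n
Unique-⊆⇒length≤ {xs = x ∷ xs} (x∉xs ∷ !xs) xs⊆ys with ys′ , eq , keep ← ∈-remove (xs⊆ys (here refl)) =
  subst (suc (length xs) ≤_) (sym eq)
    (s≤s (Unique-⊆⇒length≤ !xs λ y∈xs →
      keep (xs⊆ys (there y∈xs)) (λ { refl → All.lookup x∉xs y∈xs refl })))

length≤numAbelSq : ∀ {w : List (Fin σ)} {xs} → Unique xs → xs ⊆ abelSqPVs w → length xs ≤ numAbelSq w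
length≤numAbelSq !xs xs⊆ = Unique-⊆⇒length≤ !xs (λ x∈xs → ∈-deduplicate⁺ (≡-dec _≟_) (xs⊆ x∈xs))

length-cartesianProduct : ∀ {B : Set} (xs : List A) (ys : List B) →
  length (cartesianProduct xs ys) ≡ length xs * length ys
length-cartesianProduct []       ys = refl
length-cartesianProduct (x ∷ xs) ys =
  trans (length-++ (map (x ,_) ys)) (cong₂ _+_ (length-map (x ,_) ys) (length-cartesianProduct xs ys))

length-allFin : ∀ n → length (allFin n) ≡ n
length-allFin n = length-tabulate {n = n} (λ i → i)

∈-allWords : ∀ σ (w : List (Fin σ)) → w ∈ allWords σ (length w)
∈-allWords σ []      = here refl
∈-allWords σ (x ∷ w) =
  ∈-concat⁺′ (∈-map⁺ (_∷ w) (∈-allFin x)) (∈-map⁺ (λ w → map (_∷ w) (allFin σ)) (∈-allWords σ w))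

≤-foldr-⊔ : ∀ {x xs} → x ∈ xs → x ≤ foldr _⊔_ 0 xs
≤-foldr-⊔ {xs = y ∷ xs} (here refl) = m≤m⊔n y _
≤-foldr-⊔ {xs = y ∷ xs} (there p)   = ≤-trans (≤-foldr-⊔ p) (m≤n⊔m y _)

numAbelSq≤SQ'Abel : ∀ (w : List (Fin σ)) → numAbelSq w ≤ SQ'Abel (length w) σ
numAbelSq≤SQ'Abel {σ} w = ≤-foldr-⊔ (∈-map⁺ numAbelSq (∈-allWords σ w))

-- With i′ = t − 1 − i and j′ = 2t − 1 − j these are the p and q of the construction, and
-- halfCount is h.
leftPairs : ℕ → ℕ → ℕ → ℕ
leftPairs t i j′ = t * j′ + (t + 1) * i + t

rightPairs : ℕ → ℕ → ℕ → ℕ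
rightPairs t i′ j = t * j + (t + 1) * i′ + t * t + 1

halfCount : ℕ → ℕ → ℕ → ℕ
halfCount t i j = t * (t + t) + (i + (i + j) * t)

leftPairs+rightPairs : ∀ t i i′ j j′ → i + suc i′ ≡ t → j′ + suc j ≡ t + t →
  leftPairs t i j′ + rightPairs t i′ j ≡ (t + t) * (t + t)
leftPairs+rightPairs .(i + suc i′) i i′ j j′ refl j′+1+j≡2t = begin
  leftPairs t i j′ + rightPairs t i′ j
    ≡⟨ solve 5 (λ t i i′ j j′ → (t :* j′ :+ (t :+ con 1) :* i :+ t)
                                  :+ (t :* j :+ (t :+ con 1) :* i′ :+ t :* t :+ con 1)
                 := t :* (j′ :+ (con 1 :+ j)) :+ ((t :+ con 1) :* (i :+ i′) :+ t :* t :+ con 1)) refl t i i′ j j′ ⟩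
  t * (j′ + suc j) + ((t + 1) * (i + i′) + t * t + 1)
    ≡⟨ cong (λ m → t * m + ((t + 1) * (i + i′) + t * t + 1)) j′+1+j≡2t ⟩
  t * (t + t) + ((t + 1) * (i + i′) + t * t + 1)
    ≡⟨ solve 2 (λ i i′ → let t = i :+ (con 1 :+ i′) in
                  t :* (t :+ t) :+ ((t :+ con 1) :* (i :+ i′) :+ t :* t :+ con 1) := (t :+ t) :* (t :+ t)) refl i i′ ⟩
  (t + t) * (t + t) ∎
  where
  open ≡-Reasoning
  t = i + suc i′

halfCount-left : ∀ t i j j′ → j′ + suc j ≡ t + t → j * (t + t) + leftPairs t i j′ ≡ halfCount t i j
halfCount-left t i j j′ j′+1+j≡2t = begin
  j * (t + t) + leftPairs t i j′
    ≡⟨ solve 4 (λ t i j j′ → j :* (t :+ t) :+ (t :* j′ :+ (t :+ con 1) :* i :+ t)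
                 := t :* (j′ :+ (con 1 :+ j)) :+ (i :+ (i :+ j) :* t)) refl t i j j′ ⟩
  t * (j′ + suc j) + (i + (i + j) * t)
    ≡⟨ cong (λ m → t * m + (i + (i + j) * t)) j′+1+j≡2t ⟩
  halfCount t i j ∎
  where open ≡-Reasoning

halfCount-right : ∀ t i i′ j → i + suc i′ ≡ t → rightPairs t i′ j + i * (2 + (t + t)) ≡ halfCount t i j
halfCount-right .(i + suc i′) i i′ j refl =
  solve 3 (λ i i′ j → let t = i :+ (con 1 :+ i′) in
             t :* j :+ (t :+ con 1) :* i′ :+ t :* t :+ con 1 :+ i :* (con 2 :+ (t :+ t))
             := t :* (t :+ t) :+ (i :+ (i :+ j) :* t)) refl i i′ j

1≤halfCount : ∀ t i j .{{_ : NonZero t}} → 1 ≤ halfCount t i j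
1≤halfCount t i j = ≤-trans (*-mono-≤ 1≤t (≤-trans 1≤t (m≤m+n t t))) (m≤m+n (t * (t + t)) _)
  where 1≤t = >-nonZero⁻¹ t

halfCount-injective : ∀ {t i j k l} .{{_ : NonZero t}} → i < t → k < t →
  halfCount t i j ≡ halfCount t k l → i ≡ k × j ≡ l
halfCount-injective {t} {i} {j} {k} {l} i<t k<t eq = i≡k , +-cancelˡ-≡ i j l (*-cancelʳ-≡ (i + j) (i + l) t quot≡)
  where
  open ≡-Reasoning
  rem≡ : i + (i + j) * t ≡ k + (k + l) * t
  rem≡ = +-cancelˡ-≡ (t * (t + t)) _ _ eq
  i≡k : i ≡ k
  i≡k = begin
    i                      ≡⟨ m<n⇒m%n≡m i<t ⟨
    i % t                  ≡⟨ [m+kn]%n≡m%n i (i + j) t ⟨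
    (i + (i + j) * t) % t  ≡⟨ cong (_% t) rem≡ ⟩
    (k + (k + l) * t) % t  ≡⟨ [m+kn]%n≡m%n k (k + l) t ⟩
    k % t                  ≡⟨ m<n⇒m%n≡m k<t ⟩
    k                      ∎
  quot≡ : (i + j) * t ≡ (i + l) * t
  quot≡ = +-cancelˡ-≡ i _ _ (trans rem≡ (cong (λ m → m + (m + l) * t) (sym i≡k)))

module Construction (s t : ℕ) .{{_ : NonZero t}} where

  Letter : Set
  Letter = Fin (suc (suc s))

  a b : Letter
  a = 0F
  b = 1F

  ab blockA blockB word : List Letter
  ab = a ∷ b ∷ []
  blockA = copies (t + t) [ a ] ++ copies (t + t) [ b ]
  blockB = copies (2 + (t + t)) [ b ] ++ copies (2 + (t + t)) [ a ]
  word = copies (t + t) blockA ++ copies ((t + t) * (t + t)) ab ++ copies t blockB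

  weight-ab : ∀ (f : Letter → ℕ) → weight f ab ≡ f a + f b
  weight-ab f = cong (f a +_) (+-identityʳ (f b))

  weight-copies-singleton : ∀ (f : Letter → ℕ) n c → weight f (copies n [ c ]) ≡ n * f c
  weight-copies-singleton f n c = trans (weight-copies f n [ c ]) (cong (n *_) (+-identityʳ (f c)))

  weight-block : ∀ (f : Letter → ℕ) k c d → weight f (copies k [ c ] ++ copies k [ d ]) ≡ k * (f c + f d)
  weight-block f k c d = begin
    weight f (copies k [ c ] ++ copies k [ d ])  ≡⟨ weight-++ f (copies k [ c ]) _ ⟩
    weight f (copies k [ c ]) + weight f (copies k [ d ])
      ≡⟨ cong₂ _+_ (weight-copies-singleton f k c) (weight-copies-singleton f k d) ⟩
    k * f c + k * f d                          ≡⟨ *-distribˡ-+ k (f c) (f d) ⟨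
    k * (f c + f d)                            ∎
    where open ≡-Reasoning

  module Square (i j z : ℕ) (i<t : i < t) (j<2t : j < t + t) (z≤2t : z ≤ t + t) where

    i′ j′ p q val : ℕ
    i′ = t ∸ suc i
    j′ = t + t ∸ suc j
    p = leftPairs t i j′
    q = rightPairs t i′ j
    val = halfCount t i j

    i+1+i′≡t : i + suc i′ ≡ t
    i+1+i′≡t = trans (+-suc i i′) (m+[n∸m]≡n i<t)

    j′+1+j≡2t : j′ + suc j ≡ t + t
    j′+1+j≡2t = m∸n+n≡m j<2t

    u v : List Letter
    u = copies z [ b ] ++ copies j blockA ++ copies p ab
    v = copies q ab ++ copies i blockB ++ copies z [ b ]

    halfWeight : (Letter → ℕ) → ℕ
    halfWeight f = z * f b + val * (f a + f b)

    weight-u : ∀ f → weight f u ≡ halfWeight f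
    weight-u f = begin
      weight f u
        ≡⟨ weight-++ f (copies z [ b ]) _ ⟩
      weight f (copies z [ b ]) + weight f (copies j blockA ++ copies p ab)
        ≡⟨ cong (weight f (copies z [ b ]) +_) (weight-++ f (copies j blockA) _) ⟩
      weight f (copies z [ b ]) + (weight f (copies j blockA) + weight f (copies p ab))
        ≡⟨ cong₂ _+_ (weight-copies-singleton f z b)
             (cong₂ _+_ (trans (weight-copies f j blockA) (cong (j *_) (weight-block f (t + t) a b)))
                        (trans (weight-copies f p ab) (cong (p *_) (weight-ab f)))) ⟩
      z * f b + (j * ((t + t) * w) + p * w)
        ≡⟨ cong (z * f b +_)
             (solve 4 (λ j t p w → j :* ((t :+ t) :* w) :+ p :* w := (j :* (t :+ t) :+ p) :* w) refl j t p w) ⟩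
      z * f b + (j * (t + t) + p) * w
        ≡⟨ cong (λ m → z * f b + m * w) (halfCount-left t i j j′ j′+1+j≡2t) ⟩
      halfWeight f ∎
      where
      open ≡-Reasoning
      w = f a + f b

    weight-v : ∀ f → weight f v ≡ halfWeight f
    weight-v f = begin
      weight f v
        ≡⟨ weight-++ f (copies q ab) _ ⟩
      weight f (copies q ab) + weight f (copies i blockB ++ copies z [ b ])
        ≡⟨ cong (weight f (copies q ab) +_) (weight-++ f (copies i blockB) _) ⟩
      weight f (copies q ab) + (weight f (copies i blockB) + weight f (copies z [ b ]))
        ≡⟨ cong₂ _+_ (trans (weight-copies f q ab) (cong (q *_) (weight-ab f)))
             (cong₂ _+_ (trans (weight-copies f i blockB) (cong (i *_) (weight-block f (2 + (t + t)) b a)))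
                        (weight-copies-singleton f z b)) ⟩
      q * w + (i * ((2 + (t + t)) * (f b + f a)) + z * f b)
        ≡⟨ solve 6 (λ q i k fa fb zb → q :* (fa :+ fb) :+ (i :* (k :* (fb :+ fa)) :+ zb)
                                        := zb :+ (q :+ i :* k) :* (fa :+ fb))
             refl q i (2 + (t + t)) (f a) (f b) (z * f b) ⟩
      z * f b + (q + i * (2 + (t + t))) * w
        ≡⟨ cong (λ m → z * f b + m * w) (halfCount-right t i i′ j i+1+i′≡t) ⟩
      halfWeight f ∎
      where
      open ≡-Reasoning
      w = f a + f b

    factorisation : ∀ pad → ∃[ pre ] ∃[ post ] word ++ pad ≡ pre ++ u ++ v ++ post
    factorisation pad = preA , postB ++ pad , (begin
      word ++ pad
        ≡⟨ cong (_++ pad) (cong₂ _++_ aPart (cong₂ _++_ middle bPart)) ⟩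
      ((preA ++ zb ++ copies j blockA) ++ (copies p ab ++ copies q ab) ++ ((copies i blockB ++ zb) ++ postB)) ++ pad
        ≡⟨ ListSolver.solve 8 (λ pre zb ja p q ib post pad →
             ((pre ⊕ zb ⊕ ja) ⊕ (p ⊕ q) ⊕ ((ib ⊕ zb) ⊕ post)) ⊕ pad
               ⊜ pre ⊕ (zb ⊕ ja ⊕ p) ⊕ (q ⊕ ib ⊕ zb) ⊕ (post ⊕ pad))
             refl preA zb (copies j blockA) (copies p ab) (copies q ab) (copies i blockB) postB pad ⟩
      preA ++ u ++ v ++ postB ++ pad ∎)
      where
      open ≡-Reasoning
      module ListSolver = MonoidSolver (++-monoid Letter)
      open ListSolver using (_⊕_; _⊜_)
      zb preA postB : List Letter
      zb = copies z [ b ]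
      preA = copies j′ blockA ++ copies (t + t) [ a ] ++ copies (t + t ∸ z) [ b ]
      postB = (copies (2 + (t + t) ∸ z) [ b ] ++ copies (2 + (t + t)) [ a ]) ++ copies i′ blockB
      aPart : copies (t + t) blockA ≡ preA ++ zb ++ copies j blockA
      aPart = copies-around j′+1+j≡2t
        (trans (cong (copies (t + t) [ a ] ++_) (copies-split (t + t ∸ z) z [ b ] (m∸n+n≡m z≤2t)))
               (sym (++-assoc (copies (t + t) [ a ]) _ _)))
      middle : copies ((t + t) * (t + t)) ab ≡ copies p ab ++ copies q ab
      middle = copies-split p q ab (leftPairs+rightPairs t i i′ j j′ i+1+i′≡t j′+1+j≡2t)
      bPart : copies t blockB ≡ (copies i blockB ++ zb) ++ postB
      bPart = copies-around i+1+i′≡t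
        (trans (cong (_++ copies (2 + (t + t)) [ a ])
                     (copies-split z (2 + (t + t) ∸ z) [ b ] (m+[n∸m]≡n (≤-trans z≤2t (m≤n+m _ 2)))))
               (++-assoc zb _ _))

    1≤|u| : 1 ≤ length u
    1≤|u| = subst (1 ≤_) (sym (trans (length≡weight u) (weight-u _)))
      (≤-trans (1≤halfCount t i j) (≤-trans (m≤m*n val 2) (m≤n+m _ _)))

    isAbelSq : IsAbelSq (u , v)
    isAbelSq = equal-weights⇒IsAbelSq {u = u} {v} 1≤|u| (λ f → trans (weight-u f) (sym (weight-v f)))

    occ-square : ∀ c → occ c (u ++ v) ≡ halfWeight (indicator c) + halfWeight (indicator c)
    occ-square c = trans (occ≡weight c (u ++ v))
      (trans (weight-++ (indicator c) u v) (cong₂ _+_ (weight-u (indicator c)) (weight-v (indicator c))))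

    occ-a : occ a (u ++ v) ≡ 2 * val
    occ-a = trans (occ-square a)
      (solve 2 (λ z h → (z :* con 0 :+ h :* con 1) :+ (z :* con 0 :+ h :* con 1) := con 2 :* h) refl z val)

    occ-b : occ b (u ++ v) ≡ 2 * (z + val)
    occ-b = trans (occ-square b)
      (solve 2 (λ z h → (z :* con 1 :+ h :* con 1) :+ (z :* con 1 :+ h :* con 1) := con 2 :* (z :+ h)) refl z val)

  Index : Set
  Index = Fin t × Fin (t + t) × Fin (t + t)

  module SquareAt (x : Index) =
    Square (toℕ (proj₁ x)) (toℕ (proj₁ (proj₂ x))) (toℕ (proj₂ (proj₂ x)))
           (toℕ<n (proj₁ x)) (toℕ<n (proj₁ (proj₂ x))) (<⇒≤ (toℕ<n (proj₂ (proj₂ x))))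

  parikhOf : Index → Vec ℕ (suc (suc s))
  parikhOf x = parikh (u ++ v) where open SquareAt x

  parikhOf-injective : ∀ {x y} → parikhOf x ≡ parikhOf y → x ≡ y
  parikhOf-injective {x@(i , j , z)} {y@(k , l , z′)} eq =
    cong₂ _,_ (toℕ-injective i≡k) (cong₂ _,_ (toℕ-injective j≡l) (toℕ-injective z≡z′))
    where
    module X = SquareAt x
    module Y = SquareAt y
    occ≡ : ∀ c → occ c (X.u ++ X.v) ≡ occ c (Y.u ++ Y.v)
    occ≡ = occ-cong {u = X.u ++ X.v} {Y.u ++ Y.v} eq
    val≡ : X.val ≡ Y.val
    val≡ = *-cancelˡ-≡ X.val Y.val 2 (trans (sym X.occ-a) (trans (occ≡ a) Y.occ-a))
    z≡z′ : toℕ z ≡ toℕ z′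
    z≡z′ = +-cancelʳ-≡ Y.val (toℕ z) (toℕ z′)
      (trans (cong (toℕ z +_) (sym val≡)) (*-cancelˡ-≡ _ _ 2 (trans (sym X.occ-b) (trans (occ≡ b) Y.occ-b))))
    i≡k = proj₁ (halfCount-injective (toℕ<n i) (toℕ<n k) val≡)
    j≡l = proj₂ (halfCount-injective (toℕ<n i) (toℕ<n k) val≡)

  indices : List Index
  indices = cartesianProduct (allFin t) (cartesianProduct (allFin (t + t)) (allFin (t + t)))

  squares : List (Vec ℕ (suc (suc s)))
  squares = map parikhOf indices

  Unique-squares : Unique squares
  Unique-squares = Unique.map⁺ parikhOf-injective
    (Unique.cartesianProduct⁺ (Unique.allFin⁺ t)
      (Unique.cartesianProduct⁺ (Unique.allFin⁺ (t + t)) (Unique.allFin⁺ (t + t))))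

  length-squares : length squares ≡ t * ((t + t) * (t + t))
  length-squares = trans (length-map parikhOf indices)
    (trans (length-cartesianProduct (allFin t) (cartesianProduct (allFin (t + t)) (allFin (t + t))))
      (cong₂ _*_ (length-allFin t)
        (trans (length-cartesianProduct (allFin (t + t)) (allFin (t + t)))
               (cong₂ _*_ (length-allFin (t + t)) (length-allFin (t + t))))))

  squares⊆abelSqPVs : ∀ pad → squares ⊆ abelSqPVs (word ++ pad)
  squares⊆abelSqPVs pad c∈squares with x , _ , refl ← ∈-map⁻ parikhOf c∈squares
                                  with pre , post , eq ← SquareAt.factorisation x pad =
    subst (λ w → parikhOf x ∈ abelSqPVs w) (sym eq) (∈-abelSqPVs pre u v post isAbelSq)
    where open SquareAt x

  length-word : length word ≡ 20 * (t * t) + 4 * t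
  length-word = begin
    length word                                  ≡⟨ length≡weight word ⟩
    weight one word                              ≡⟨ weight-++ one (copies (t + t) blockA) _ ⟩
    weight one (copies (t + t) blockA) + weight one (copies ((t + t) * (t + t)) ab ++ copies t blockB)
      ≡⟨ cong₂ _+_ (trans (weight-copies one (t + t) blockA) (cong ((t + t) *_) (weight-block one (t + t) a b)))
                   (trans (weight-++ one (copies ((t + t) * (t + t)) ab) _)
                          (cong₂ _+_ (weight-copies one ((t + t) * (t + t)) ab)
                                     (trans (weight-copies one t blockB) (cong (t *_) (weight-block one (2 + (t + t)) b a))))) ⟩
    (t + t) * ((t + t) * 2) + ((t + t) * (t + t) * 2 + t * ((2 + (t + t)) * 2))
      ≡⟨ solve 1 (λ t → (t :+ t) :* ((t :+ t) :* con 2)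
                          :+ ((t :+ t) :* (t :+ t) :* con 2 :+ t :* ((con 2 :+ (t :+ t)) :* con 2))
                         := con 20 :* (t :* t) :+ con 4 :* t) refl t ⟩
    20 * (t * t) + 4 * t                         ∎
    where
    open ≡-Reasoning
    one : Letter → ℕ
    one _ = 1

  length-word≤ : length word ≤ 24 * (t * t)
  length-word≤ = begin
    length word             ≡⟨ length-word ⟩
    20 * (t * t) + 4 * t    ≤⟨ +-monoʳ-≤ (20 * (t * t)) (*-monoʳ-≤ 4 (m≤m*n t t)) ⟩
    20 * (t * t) + 4 * (t * t) ≡⟨ solve 1 (λ x → con 20 :* x :+ con 4 :* x := con 24 :* x) refl (t * t) ⟩
    24 * (t * t)            ∎
    where open ≤-Reasoning

  t[2t]²≤SQ'Abel : ∀ {n} → length word ≤ n → t * ((t + t) * (t + t)) ≤ SQ'Abel n (suc (suc s))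
  t[2t]²≤SQ'Abel {n} |word|≤n = begin
    t * ((t + t) * (t + t))        ≡⟨ length-squares ⟨
    length squares                 ≤⟨ length≤numAbelSq {w = word ++ pad} Unique-squares (squares⊆abelSqPVs pad) ⟩
    numAbelSq (word ++ pad)        ≤⟨ numAbelSq≤SQ'Abel (word ++ pad) ⟩
    SQ'Abel (length (word ++ pad)) (suc (suc s)) ≡⟨ cong (λ m → SQ'Abel m (suc (suc s))) |word++pad|≡n ⟩
    SQ'Abel n (suc (suc s))        ∎
    where
    open ≤-Reasoning
    pad = copies (n ∸ length word) [ a ]
    |word++pad|≡n : length (word ++ pad) ≡ n
    |word++pad|≡n =
      trans (length-++ word) (trans (cong (length word +_) (length-copies-singleton _)) (m+[n∸m]≡n |word|≤n))

square-bracket : ∀ c .{{_ : NonZero c}} n → c ≤ n →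
  ∃[ t ] NonZero t × c * (t * t) ≤ n × n < c * (suc t * suc t)
square-bracket c zero    c≤0   = contradiction c≤0 (<⇒≱ (>-nonZero⁻¹ c))
square-bracket c (suc n) c≤1+n with c ≤? n
... | no c≰n =
  1 , _ , ≤-reflexive (trans (*-identityʳ c) c≡1+n) , subst (_< c * 4) c≡1+n (m<m*n c 4 (s≤s (s≤s z≤n)))
  where
  c≡1+n : c ≡ suc n
  c≡1+n = ≤-antisym c≤1+n (≰⇒> c≰n)
... | yes c≤n with t , t≢0 , lower , upper ← square-bracket c n c≤n with m≤n⇒m<n∨m≡n upper
...   | inj₁ 1+n<next = t , t≢0 , m≤n⇒m≤1+n lower , 1+n<next
...   | inj₂ 1+n≡next = suc t , _ , ≤-reflexive (sym 1+n≡next) ,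
          subst (_< c * (suc (suc t) * suc (suc t))) (sym 1+n≡next) (*-monoʳ-< c (*-mono-< (n<1+n (suc t)) (n<1+n (suc t))))

[1+t]²≤4t² : ∀ t .{{_ : NonZero t}} → suc t * suc t ≤ 4 * (t * t)
[1+t]²≤4t² t = ≤-trans (*-mono-≤ 1+t≤2t 1+t≤2t)
  (≤-reflexive (solve 1 (λ t → (t :+ t) :* (t :+ t) := con 4 :* (t :* t)) refl t))
  where
  1+t≤2t : suc t ≤ t + t
  1+t≤2t = +-monoˡ-≤ t (>-nonZero⁻¹ t)

[c*t²]³≡c³*[t³]² : ∀ c t → (c * (t * t)) ^ 3 ≡ c ^ 3 * (t * (t * t)) ^ 2
[c*t²]³≡c³*[t³]² = solve 2 (λ c t → (c :* (t :* t)) :^ 3 := c :^ 3 :* (t :* (t :* t)) :^ 2) refl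

16*[t³]²≡[t*[2t]²]² : ∀ t → 16 * (t * (t * t)) ^ 2 ≡ (t * ((t + t) * (t + t))) ^ 2
16*[t³]²≡[t*[2t]²]² = solve 1 (λ t → con 16 :* (t :* (t :* t)) :^ 2 := (t :* ((t :+ t) :* (t :+ t))) :^ 2) refl

-- Terms under `55296 *` are kept syntactically equal to their counterparts (hence the separate
-- solver lemmas, and `suc (suc s)` rather than `2 + s`): otherwise the conversion checker
-- unfolds the multiplication.
n³≤55296*SQ'Abel² : ∀ s n t .{{_ : NonZero t}} → 24 * (t * t) ≤ n → n < 24 * (suc t * suc t) →
  n ^ 3 ≤ 55296 * (SQ'Abel n (suc (suc s)) ^ 2)
n³≤55296*SQ'Abel² s n t 24t²≤n n<24[1+t]² = begin
  n ^ 3                                  ≤⟨ ^-monoˡ-≤ 3 n≤96t² ⟩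
  (96 * (t * t)) ^ 3                     ≡⟨ [c*t²]³≡c³*[t³]² 96 t ⟩
  96 ^ 3 * (t * (t * t)) ^ 2             ≡⟨ *-assoc 55296 16 ((t * (t * t)) ^ 2) ⟩
  55296 * (16 * (t * (t * t)) ^ 2)       ≡⟨ cong (55296 *_) (16*[t³]²≡[t*[2t]²]² t) ⟩
  55296 * (t * ((t + t) * (t + t))) ^ 2  ≤⟨ *-monoʳ-≤ 55296 (^-monoˡ-≤ 2 t[2t]²≤SQ'Abel-n) ⟩
  55296 * (SQ'Abel n (suc (suc s)) ^ 2)  ∎
  where
  open ≤-Reasoning
  open Construction s t
  n≤96t² : n ≤ 96 * (t * t)
  n≤96t² = ≤-trans (<⇒≤ n<24[1+t]²)
    (≤-trans (*-monoʳ-≤ 24 ([1+t]²≤4t² t)) (≤-reflexive (sym (*-assoc 24 4 (t * t)))))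
  t[2t]²≤SQ'Abel-n : t * ((t + t) * (t + t)) ≤ SQ'Abel n (suc (suc s))
  t[2t]²≤SQ'Abel-n = t[2t]²≤SQ'Abel (≤-trans length-word≤ 24t²≤n)

theorem8 : (σ : ℕ) → 2 ≤ σ →
    ∃[ d ] ∃[ N ] ((n : ℕ) → N ≤ n → n ^ 3 ≤ d * (SQ'Abel n σ ^ 2))
theorem8 (suc (suc s)) (s≤s (s≤s z≤n)) = 55296 , 24 , λ n 24≤n →
  let t , t≢0 , 24t²≤n , n<24[1+t]² = square-bracket 24 n 24≤n in
  n³≤55296*SQ'Abel² s n t {{t≢0}} 24t²≤n n<24[1+t]²
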